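{- Let $\pi=\pi_1\cdots\pi_n$ be a permutation of $\{1,\dots,n\}$. The Schröder insertion tableau of $\pi$ has a single column (i.e. every row of it has at most two cells) if and only if $\pi$ avoids both patterns $123$ and $213$.
   Context: A permutation $\tau$ contains a pattern $\sigma$ (of length $k$) if there are indices $i_1<\dots<i_k$ with $\tau_{i_1}\cdots\tau_{i_k}$ order-isomorphic to $\sigma$; otherwise it avoids $\sigma$. A (partial) Schröder tableau is stored as a sequence of rows; row $r$ is a sequence of cells at positions $1,\dots,\ell_r$, each containing a number; odd positions are upper triangles and even positions lower triangles (positions $2c-1,2c$ form the square in column $c$). Schröder insertion of $\alpha$ into a tableau: set $i=1$ and repeat: if row $i$ does not exist or $\alpha$ exceeds every entry of row $i$, append a new cell containing $\alpha$ at the end of row $i$ and stop. Otherwise let $j$ be the position in row $i$ of the smallest entry $\gamma>\alpha$. If $j$ is even, write $\alpha$ at $j$, set $\alpha:=\gamma$, $i:=i+1$, repeat. If $j$ is odd and last in row $i$, write $\alpha$ at $j$, append a new cell at position $j+1$ containing $\gamma$, stop. If $j$ is odd and not last, let $\beta$ be the entry at $j+1$; write $\alpha$ at $j$ and $\gamma$ at $j+1$, set $\alpha:=\beta$, $i:=i+1$, repeat. The Schröder insertion tableau of $\pi$ is obtained from the one-cell tableau containing $\pi_1$ by successively inserting $\pi_2,\dots,\pi_n$. -}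

module Defs where

open import Data.Nat using (ℕ; zero; suc; _<_; _<ᵇ_; _≤_)
open import Data.Bool using (Bool; true; false; if_then_else_)
open import Data.List using (List; []; _∷_; _++_; length; map; upTo; lookup; [_])
open import Data.List.Relation.Binary.Permutation.Propositional using (_↭_)
open import Data.List.Relation.Binary.Sublist.Propositional using (_⊆_)
open import Data.Fin using (Fin; toℕ)
open import Data.Product using (Σ; _×_; ∃-syntax)
open import Data.Maybe using (Maybe; just; nothing)
open import Relation.Binary.PropositionalEquality using (_≡_)
open import Function using (_⇔_)
open import Relation.Nullary using (¬_)
import Data.List.Membership.Propositional
import Data.Fin

IsPerm : ℕ → List ℕ → Set
IsPerm n π = π ↭ map suc (upTo n)

OrderIso : List ℕ → List ℕ → Set
OrderIso τ σ = Σ (length τ ≡ length σ) λ eq →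
  ∀ (i j : Fin (length τ)) →
    (lookup τ i < lookup τ j) ⇔ (lookup σ (Data.Fin.cast eq i) < lookup σ (Data.Fin.cast eq j))

Contains : List ℕ → List ℕ → Set
Contains τ σ = ∃[ ρ ] (ρ ⊆ τ × OrderIso ρ σ)

Avoids : List ℕ → List ℕ → Set
Avoids τ σ = ¬ Contains τ σ

Row : Set
Row = List ℕ

-- a tableau is a list of rows (row 1 first); row cells at positions 1,…,ℓ
Tableau : Set
Tableau = List Row

exceedsAll : ℕ → Row → Bool
exceedsAll α [] = true
exceedsAll α (x ∷ xs) = if x <ᵇ α then exceedsAll α xs else false

smallestAbove : ℕ → ℕ → Row → Maybe (ℕ × ℕ) → Maybe (ℕ × ℕ)
smallestAbove α pos [] acc = acc
smallestAbove α pos (x ∷ xs) nothing =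
  smallestAbove α (suc pos) xs (if α <ᵇ x then just (pos Data.Product., x) else nothing)
smallestAbove α pos (x ∷ xs) (just (p Data.Product., g)) =
  smallestAbove α (suc pos) xs
    (if α <ᵇ x then (if x <ᵇ g then just (pos Data.Product., x) else just (p Data.Product., g))
               else just (p Data.Product., g))

-- entry at 1-based position (default 0, unused)
entryAt : ℕ → Row → ℕ
entryAt _ [] = 0
entryAt (suc zero) (x ∷ xs) = x
entryAt zero (x ∷ xs) = x
entryAt (suc (suc k)) (x ∷ xs) = entryAt (suc k) xs

setAt : ℕ → ℕ → Row → Row
setAt _ v [] = []
setAt zero v (x ∷ xs) = v ∷ xs
setAt (suc zero) v (x ∷ xs) = v ∷ xs
setAt (suc (suc k)) v (x ∷ xs) = x ∷ setAt (suc k) v xs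

isEven : ℕ → Bool
isEven zero = true
isEven (suc zero) = false
isEven (suc (suc k)) = isEven k

schroderInsert : ℕ → Tableau → Tableau
schroderInsert α [] = [ [ α ] ]
schroderInsert α (row ∷ rows) with exceedsAll α row
... | true = (row ++ [ α ]) ∷ rows
... | false with smallestAbove α 1 row nothing
...   | nothing = (row ++ [ α ]) ∷ rows   -- impossible case
...   | just (j Data.Product., γ) with isEven j
...     | true = setAt j α row ∷ schroderInsert γ rows
...     | false with length row Data.Nat.≡ᵇ j
...       | true = (setAt j α row ++ [ γ ]) ∷ rows
...       | false = setAt (suc j) γ (setAt j α row) ∷ schroderInsert (entryAt (suc j) row) rows

insertAll : List ℕ → Tableau → Tableau
insertAll [] T = T
insertAll (x ∷ xs) T = insertAll xs (schroderInsert x T)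

schroderTableau : List ℕ → Tableau
schroderTableau [] = []
schroderTableau (π₁ ∷ πs) = insertAll πs [ [ π₁ ] ]

SingleColumn : Tableau → Set
SingleColumn T = ∀ r → r Data.List.Membership.Propositional.∈ T → length r ≤ 2

-- As long as the word read so far avoids 123 and 213, its insertion tableau is the
-- single column obtained by writing its entries in increasing order two per row: a new
-- entry α has at most one smaller entry before it, so it either enters in front (pushing
-- every entry one cell further) or replaces the second entry of the first row, which is
-- then pushed into the rows below. The first entry completing a 123 or 213 exceeds both
-- cells of the first row and is appended there, giving a row of three cells; Schröder
-- insertion never shortens a row, so that row survives to the final tableau.
module Submission where

open import Defs
open import Data.Bool using (true; false; T)
open import Data.Bool.Properties using (T-≡)
open import Data.Empty using (⊥; ⊥-elim)
open import Data.Fin using (zero; suc)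
open import Data.List using (List; []; _∷_; [_]; _++_; length)
open import Data.List.Properties using (length-++-≤ˡ; ++-identityʳ; ∷ʳ-injective; ∷ʳ-++)
open import Data.List.Membership.Propositional using (_∈_; _∉_; find)
open import Data.List.Membership.Propositional.Properties using (∈-++⁺ˡ)
open import Data.List.Relation.Binary.Permutation.Propositional
  using (_↭_; ↭-refl; ↭-sym; ↭-trans; prep; swap; ↭⇒↭ₛ)
open import Data.List.Relation.Binary.Permutation.Propositional.Properties
  using (∈-resp-↭; ∷↭∷ʳ; shift)
import Data.List.Relation.Binary.Permutation.Setoid.Properties as ↭ₛ
open import Data.List.Relation.Binary.Sublist.Propositional
  using (_⊆_; []; _∷_; _∷ʳ_; ⊆-refl; ⊆-trans; from∈; lookup)
open import Data.List.Relation.Binary.Sublist.Propositional.Properties using (++⁺; ++⁺ʳ)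
open import Data.List.Relation.Unary.All as All using (All; []; _∷_)
open import Data.List.Relation.Unary.AllPairs using (AllPairs; []; _∷_)
open import Data.List.Relation.Unary.Any using (Any; here; there)
open import Data.List.Relation.Unary.Unique.Propositional using (Unique)
open import Data.List.Relation.Unary.Unique.Propositional.Properties
  using (map⁺; upTo⁺; Unique[x∷xs]⇒x∉xs)
open import Data.Maybe using (just; nothing)
open import Data.Nat using (ℕ; zero; suc; _<_; _≤_; _<ᵇ_; _≡ᵇ_; _<?_; z≤n; s≤s; z<s; s<s)
open import Data.Nat.Properties
  using ( ≤-refl; ≤-trans; <-trans; <-≤-trans; ≤-<-trans; <-cmp; <-asym
        ; <-irrefl; <⇒≤; <⇒≢; <⇒≱; ≤⇒≯; <⇒<ᵇ; <ᵇ⇒<; suc-injective)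
open import Data.Product using (_×_; _,_; ∃-syntax)
import Data.Product as Product
open import Data.Sum as Sum using (_⊎_; inj₁; inj₂)
open import Function using (_⇔_; id; _∘_; const; mk⇔; Equivalence)
import Function.Properties.Equivalence as ⇔
open import Relation.Binary.Definitions using (tri<; tri≈; tri>)
open import Relation.Binary.PropositionalEquality
  using (_≡_; _≢_; refl; sym; subst; setoid; ≢-sym)
open import Relation.Nullary using (¬_; Dec; yes; no; contradiction)

private
  variable
    a y α : ℕ
    s τ : List ℕ

<ᵇ-true : ∀ {m n} → m < n → (m <ᵇ n) ≡ true
<ᵇ-true = Equivalence.to T-≡ ∘ <⇒<ᵇ

<ᵇ-false : ∀ {m n} → n ≤ m → (m <ᵇ n) ≡ false
<ᵇ-false {m} {n} n≤m with m <ᵇ n in eq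
... | false = refl
... | true  = contradiction (<ᵇ⇒< m n (subst T (sym eq) _)) (≤⇒≯ n≤m)

unique-resp-↭ : {xs ys : List ℕ} → xs ↭ ys → Unique xs → Unique ys
unique-resp-↭ = ↭ₛ.Unique-resp-↭ (setoid ℕ) ∘ ↭⇒↭ₛ

isPerm⇒unique : ∀ {n π} → IsPerm n π → Unique π
isPerm⇒unique {n} p = unique-resp-↭ (↭-sym p) (map⁺ suc-injective (upTo⁺ n))

unique-++-∷⇒∉ : ∀ xs {ys} → Unique (xs ++ y ∷ ys) → y ∉ xs
unique-++-∷⇒∉ xs {ys} u = Unique[x∷xs]⇒x∉xs (unique-resp-↭ (shift _ xs ys) u) ∘ ∈-++⁺ˡ

Sorted : List ℕ → Set
Sorted = AllPairs _<_

columnTableau : List ℕ → Tableau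
columnTableau []          = []
columnTableau (a ∷ [])    = [ [ a ] ]
columnTableau (a ∷ b ∷ s) = (a ∷ b ∷ []) ∷ columnTableau s

columnTableau-singleColumn : ∀ s → SingleColumn (columnTableau s)
columnTableau-singleColumn (a ∷ [])    _ (here refl) = s≤s z≤n
columnTableau-singleColumn (a ∷ b ∷ s) _ (here refl) = ≤-refl
columnTableau-singleColumn (a ∷ b ∷ s) r (there r∈) = columnTableau-singleColumn s r r∈

sorted-head-≤ : Sorted (a ∷ s) → y ∈ a ∷ s → a ≤ y
sorted-head-≤ _         (here refl) = ≤-refl
sorted-head-≤ (a<s ∷ _) (there y∈s) = <⇒≤ (All.lookup a<s y∈s)

insert-columnTableau-min : Sorted s → All (α <_) s →
  schroderInsert α (columnTableau s) ≡ columnTableau (α ∷ s)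
insert-columnTableau-min {[]} _ _ = refl
insert-columnTableau-min {a ∷ []} {α} _ (α<a ∷ [])
  rewrite <ᵇ-false (<⇒≤ α<a) | <ᵇ-true α<a = refl
insert-columnTableau-min {a ∷ b ∷ s} {α} ((a<b ∷ _) ∷ b<s ∷ sorted) (α<a ∷ α<b ∷ _)
  rewrite <ᵇ-false (<⇒≤ α<a) | <ᵇ-true α<a | <ᵇ-true α<b | <ᵇ-false (<⇒≤ a<b)
        | insert-columnTableau-min sorted b<s = refl

-- For sorted s this says that at least two entries of s lie below α.
TwoBelow : ℕ → List ℕ → Set
TwoBelow α (_ ∷ b ∷ _) = b < α
TwoBelow α _           = ⊥

twoBelow? : ∀ α s → Dec (TwoBelow α s)
twoBelow? α []          = no id
twoBelow? α (_ ∷ [])    = no id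
twoBelow? α (_ ∷ b ∷ _) = b <? α

insert-columnTableau : Sorted s → α ∉ s → ¬ TwoBelow α s →
  ∃[ s′ ] Sorted s′ × s′ ↭ α ∷ s × schroderInsert α (columnTableau s) ≡ columnTableau s′
insert-columnTableau {[]} {α} _ _ _ = [ α ] , [] ∷ [] , ↭-refl , refl
insert-columnTableau {a ∷ []} {α} sorted α∉ _ with <-cmp α a
... | tri< α<a _ _ =
  α ∷ a ∷ [] , (α<a ∷ []) ∷ sorted , ↭-refl , insert-columnTableau-min sorted (α<a ∷ [])
... | tri≈ _ refl _ = contradiction (here refl) α∉
... | tri> _ _ a<α rewrite <ᵇ-true a<α =
  a ∷ α ∷ [] , (a<α ∷ []) ∷ [] ∷ [] , swap a α ↭-refl , refl
insert-columnTableau {a ∷ b ∷ s} {α} sorted@((a<b ∷ a<s) ∷ b<s ∷ sorted-s) α∉ ¬b<α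
  with <-cmp α b
... | tri≈ _ refl _ = contradiction (there (here refl)) α∉
... | tri> _ _ b<α  = contradiction b<α ¬b<α
... | tri< α<b _ _ with <-cmp α a
...   | tri< α<a _ _ = let α<abs = α<a ∷ α<b ∷ All.map (<-trans α<a) a<s in
  α ∷ a ∷ b ∷ s , α<abs ∷ sorted , ↭-refl , insert-columnTableau-min sorted α<abs
...   | tri≈ _ refl _ = contradiction (here refl) α∉
...   | tri> _ _ a<α
  rewrite <ᵇ-true a<α | <ᵇ-false (<⇒≤ α<b) | <ᵇ-false (<⇒≤ a<α) | <ᵇ-true α<b
        | insert-columnTableau-min sorted-s b<s
  = a ∷ α ∷ b ∷ s
  , (a<α ∷ a<b ∷ a<s) ∷ (α<b ∷ All.map (<-trans α<b) b<s) ∷ b<s ∷ sorted-s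
  , swap a α ↭-refl
  , refl

Wide : Tableau → Set
Wide = Any (λ r → 2 < length r)

wide⇒¬singleColumn : ∀ {T} → Wide T → ¬ SingleColumn T
wide⇒¬singleColumn w sc with r , r∈T , 2<r ← find w = <⇒≱ 2<r (sc r r∈T)

wide-∷ : ∀ {r r′ rs rs′} → length r ≤ length r′ → (Wide rs → Wide rs′) →
  Wide (r ∷ rs) → Wide (r′ ∷ rs′)
wide-∷ r≤r′ _    (here 2<r)  = here (<-≤-trans 2<r r≤r′)
wide-∷ _    rs⇒rs′ (there w) = there (rs⇒rs′ w)

length-≤-setAt : ∀ k v (r : Row) → length r ≤ length (setAt k v r)
length-≤-setAt _             _ []      = z≤n
length-≤-setAt zero          _ (_ ∷ _) = ≤-refl
length-≤-setAt (suc zero)    _ (_ ∷ _) = ≤-refl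
length-≤-setAt (suc (suc k)) v (_ ∷ r) = s≤s (length-≤-setAt (suc k) v r)

schroderInsert-wide : ∀ α T → Wide T → Wide (schroderInsert α T)
schroderInsert-wide α (row ∷ rows) w with exceedsAll α row
... | true = wide-∷ (length-++-≤ˡ row) id w
... | false with smallestAbove α 1 row nothing
...   | nothing = wide-∷ (length-++-≤ˡ row) id w
...   | just (j , γ) with isEven j
...     | true  = wide-∷ (length-≤-setAt j α row) (schroderInsert-wide γ rows) w
...     | false with length row ≡ᵇ j
...       | true  = wide-∷ (≤-trans (length-≤-setAt j α row) (length-++-≤ˡ (setAt j α row))) id w
...       | false = wide-∷ (≤-trans (length-≤-setAt j α row) (length-≤-setAt (suc j) γ (setAt j α row)))
                           (schroderInsert-wide (entryAt (suc j) row) rows) w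

insertAll-wide : ∀ xs {T} → Wide T → Wide (insertAll xs T)
insertAll-wide []       w = w
insertAll-wide (x ∷ xs) w = insertAll-wide xs (schroderInsert-wide x _ w)

insert-columnTableau-wide : Sorted s → TwoBelow α s → Wide (schroderInsert α (columnTableau s))
insert-columnTableau-wide {a ∷ b ∷ s} ((a<b ∷ _) ∷ _) b<α
  rewrite <ᵇ-true (<-trans a<b b<α) | <ᵇ-true b<α = here ≤-refl

Contains123or213 : List ℕ → Set
Contains123or213 τ = ∃[ x ] ∃[ y ] ∃[ z ] (x ≢ y × x < z × y < z × (x ∷ y ∷ z ∷ []) ⊆ τ)

PairBelow : ℕ → List ℕ → Set
PairBelow α τ = ∃[ x ] ∃[ y ] (x ≢ y × x ∈ τ × y ∈ τ × x < α × y < α)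

contains-⊆ : {τ τ′ : List ℕ} → τ ⊆ τ′ → Contains123or213 τ → Contains123or213 τ′
contains-⊆ τ⊆τ′ (x , y , z , x≢y , x<z , y<z , xyz⊆τ) = x , y , z , x≢y , x<z , y<z , ⊆-trans xyz⊆τ τ⊆τ′

pairBelow-resp-↭ : {τ τ′ : List ℕ} → τ ↭ τ′ → PairBelow α τ → PairBelow α τ′
pairBelow-resp-↭ τ↭τ′ (x , y , x≢y , x∈ , y∈ , x<α , y<α) =
  x , y , x≢y , ∈-resp-↭ τ↭τ′ x∈ , ∈-resp-↭ τ↭τ′ y∈ , x<α , y<α

twoBelow⇒pairBelow : Sorted s → TwoBelow α s → PairBelow α s
twoBelow⇒pairBelow {a ∷ b ∷ _} ((a<b ∷ _) ∷ _) b<α =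
  a , b , <⇒≢ a<b , here refl , there (here refl) , <-trans a<b b<α , b<α

-- Of two distinct entries below α, one differs from the least entry of s and so is
-- at least the second least entry.
pairBelow⇒twoBelow : Sorted s → PairBelow α s → TwoBelow α s
pairBelow⇒twoBelow {a ∷ []} _ (_ , _ , x≢y , here refl , here refl , _) = x≢y refl
pairBelow⇒twoBelow {a ∷ b ∷ s} (_ ∷ sorted) (x , y , x≢y , x∈ , y∈ , x<α , y<α) with x∈ | y∈
... | there x∈bs | _          = ≤-<-trans (sorted-head-≤ sorted x∈bs) x<α
... | here refl  | there y∈bs = ≤-<-trans (sorted-head-≤ sorted y∈bs) y<α
... | here refl  | here refl  = contradiction refl x≢y

∈-∈⇒⊆ : ∀ {A : Set} {x y : A} {ys} → x ∈ ys → y ∈ ys → x ≢ y →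
  (x ∷ y ∷ []) ⊆ ys ⊎ (y ∷ x ∷ []) ⊆ ys
∈-∈⇒⊆ (here refl)  (here refl)  x≢y = contradiction refl x≢y
∈-∈⇒⊆ (here refl)  (there y∈ys) _   = inj₁ (refl ∷ from∈ y∈ys)
∈-∈⇒⊆ (there x∈ys) (here refl)  _   = inj₂ (refl ∷ from∈ x∈ys)
∈-∈⇒⊆ {ys = y ∷ _} (there x∈ys) (there y∈ys) x≢y =
  Sum.map (y ∷ʳ_) (y ∷ʳ_) (∈-∈⇒⊆ x∈ys y∈ys x≢y)

⊆-∷ʳ-split : ∀ {A : Set} {xs ys : List A} {v} → xs ⊆ ys ++ [ v ] →
  xs ⊆ ys ⊎ ∃[ xs′ ] (xs ≡ xs′ ++ [ v ] × xs′ ⊆ ys)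
⊆-∷ʳ-split {ys = []} (_ ∷ʳ [])   = inj₁ []
⊆-∷ʳ-split {ys = []} (refl ∷ []) = inj₂ ([] , refl , [])
⊆-∷ʳ-split {ys = y ∷ ys} (.y ∷ʳ xs⊆) with ⊆-∷ʳ-split xs⊆
... | inj₁ xs⊆ys                = inj₁ (y ∷ʳ xs⊆ys)
... | inj₂ (xs′ , refl , xs′⊆ys) = inj₂ (xs′ , refl , y ∷ʳ xs′⊆ys)
⊆-∷ʳ-split {ys = y ∷ ys} (refl ∷ xs⊆) with ⊆-∷ʳ-split xs⊆
... | inj₁ xs⊆ys                = inj₁ (refl ∷ xs⊆ys)
... | inj₂ (xs′ , refl , xs′⊆ys) = inj₂ (y ∷ xs′ , refl , refl ∷ xs′⊆ys)

contains-∷ʳ⇔ : ∀ τ α → Contains123or213 (τ ++ [ α ]) ⇔ (Contains123or213 τ ⊎ PairBelow α τ)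
contains-∷ʳ⇔ τ α = mk⇔ to from
  where
  to : Contains123or213 (τ ++ [ α ]) → Contains123or213 τ ⊎ PairBelow α τ
  to (x , y , z , x≢y , x<z , y<z , xyz⊆) with ⊆-∷ʳ-split xyz⊆
  ... | inj₁ xyz⊆τ = inj₁ (x , y , z , x≢y , x<z , y<z , xyz⊆τ)
  ... | inj₂ (xs′ , eq , xs′⊆τ) with ∷ʳ-injective (x ∷ y ∷ []) xs′ eq
  ...   | refl , refl = inj₂ (x , y , x≢y , lookup xs′⊆τ (here refl) , lookup xs′⊆τ (there (here refl)) , x<z , y<z)

  from : Contains123or213 τ ⊎ PairBelow α τ → Contains123or213 (τ ++ [ α ])
  from (inj₁ c) = contains-⊆ (++⁺ʳ [ α ] ⊆-refl) c
  from (inj₂ (x , y , x≢y , x∈ , y∈ , x<α , y<α)) with ∈-∈⇒⊆ x∈ y∈ x≢y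
  ... | inj₁ xy⊆τ = x , y , α , x≢y , x<α , y<α , ++⁺ xy⊆τ ⊆-refl
  ... | inj₂ yx⊆τ = y , x , α , x≢y ∘ sym , y<α , x<α , ++⁺ yx⊆τ ⊆-refl

SameOrder : ℕ → ℕ → ℕ → ℕ → Set
SameOrder a b a′ b′ = (a < b ⇔ a′ < b′) × (b < a ⇔ b′ < a′)

sameOrder : ∀ {a b a′ b′} → a < b → a′ < b′ → SameOrder a b a′ b′
sameOrder a<b a′<b′ =
  mk⇔ (const a′<b′) (const a<b) , mk⇔ (⊥-elim ∘ <-asym a<b) (⊥-elim ∘ <-asym a′<b′)

<-irrefl⇔ : ∀ {a a′} → (a < a ⇔ a′ < a′)
<-irrefl⇔ = mk⇔ (⊥-elim ∘ <-irrefl refl) (⊥-elim ∘ <-irrefl refl)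

orderIso₃ : ∀ {x y z x′ y′ z′} →
  SameOrder x y x′ y′ → SameOrder x z x′ z′ → SameOrder y z y′ z′ →
  OrderIso (x ∷ y ∷ z ∷ []) (x′ ∷ y′ ∷ z′ ∷ [])
orderIso₃ (xy , yx) (xz , zx) (yz , zy) = refl , λ where
  zero             zero             → <-irrefl⇔
  zero             (suc zero)       → xy
  zero             (suc (suc zero)) → xz
  (suc zero)       zero             → yx
  (suc zero)       (suc zero)       → <-irrefl⇔
  (suc zero)       (suc (suc zero)) → yz
  (suc (suc zero)) zero             → zx
  (suc (suc zero)) (suc zero)       → zy
  (suc (suc zero)) (suc (suc zero)) → <-irrefl⇔

contains123or213⇒ : Contains123or213 τ → Contains τ (1 ∷ 2 ∷ 3 ∷ []) ⊎ Contains τ (2 ∷ 1 ∷ 3 ∷ [])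
contains123or213⇒ (x , y , z , x≢y , x<z , y<z , xyz⊆τ) with <-cmp x y
... | tri< x<y _ _ = inj₁ (_ , xyz⊆τ ,
      orderIso₃ (sameOrder x<y (s<s z<s)) (sameOrder x<z (s<s z<s)) (sameOrder y<z (s<s (s<s z<s))))
... | tri≈ _ x≡y _ = contradiction x≡y x≢y
... | tri> _ _ y<x = inj₂ (_ , xyz⊆τ ,
      orderIso₃ (Product.swap (sameOrder y<x (s<s z<s))) (sameOrder x<z (s<s (s<s z<s)))
                (sameOrder y<z (s<s z<s)))

contains-123⇒ : Contains τ (1 ∷ 2 ∷ 3 ∷ []) → Contains123or213 τ
contains-123⇒ (_ ∷ _ ∷ _ ∷ [] , xyz⊆τ , refl , iso) =
  _ , _ , _ , <⇒≢ (Equivalence.from (iso zero (suc zero)) (s<s z<s)) ,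
  Equivalence.from (iso zero (suc (suc zero))) (s<s z<s) ,
  Equivalence.from (iso (suc zero) (suc (suc zero))) (s<s (s<s z<s)) , xyz⊆τ

contains-213⇒ : Contains τ (2 ∷ 1 ∷ 3 ∷ []) → Contains123or213 τ
contains-213⇒ (_ ∷ _ ∷ _ ∷ [] , xyz⊆τ , refl , iso) =
  _ , _ , _ , ≢-sym (<⇒≢ (Equivalence.from (iso (suc zero) zero) (s<s z<s))) ,
  Equivalence.from (iso zero (suc (suc zero))) (s<s (s<s z<s)) ,
  Equivalence.from (iso (suc zero) (suc (suc zero))) (s<s z<s) , xyz⊆τ

¬contains123or213⇔avoids : ∀ τ →
  (¬ Contains123or213 τ) ⇔ (Avoids τ (1 ∷ 2 ∷ 3 ∷ []) × Avoids τ (2 ∷ 1 ∷ 3 ∷ []))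
¬contains123or213⇔avoids τ = mk⇔
  (λ ¬c → ¬c ∘ contains-123⇒ , ¬c ∘ contains-213⇒)
  (λ (avoids-123 , avoids-213) → Sum.[ avoids-123 , avoids-213 ] ∘ contains123or213⇒)

twoBelow⇒contains-∷ʳ : Sorted s → s ↭ τ → TwoBelow α s → Contains123or213 (τ ++ [ α ])
twoBelow⇒contains-∷ʳ {τ = τ} {α} sorted s↭τ twoBelow = Equivalence.from (contains-∷ʳ⇔ τ α)
  (inj₂ (pairBelow-resp-↭ s↭τ (twoBelow⇒pairBelow sorted twoBelow)))

¬twoBelow⇒¬contains-∷ʳ : Sorted s → s ↭ τ → ¬ TwoBelow α s →
  ¬ Contains123or213 τ → ¬ Contains123or213 (τ ++ [ α ])
¬twoBelow⇒¬contains-∷ʳ {τ = τ} {α} sorted s↭τ ¬twoBelow ¬c c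
  with Equivalence.to (contains-∷ʳ⇔ τ α) c
... | inj₁ c-τ      = ¬c c-τ
... | inj₂ pairBelow = ¬twoBelow (pairBelow⇒twoBelow sorted (pairBelow-resp-↭ (↭-sym s↭τ) pairBelow))

insertAll-columnTableau : ∀ xs {s pre} → Sorted s → s ↭ pre → Unique (pre ++ xs) →
  ¬ Contains123or213 pre →
  SingleColumn (insertAll xs (columnTableau s)) ⇔ (¬ Contains123or213 (pre ++ xs))
insertAll-columnTableau [] {s} {pre} _ _ _ ¬c rewrite ++-identityʳ pre =
  mk⇔ (const ¬c) (const (columnTableau-singleColumn s))
insertAll-columnTableau (α ∷ xs) {s} {pre} sorted s↭pre unique ¬c
  rewrite sym (∷ʳ-++ pre α xs) with twoBelow? α s
... | yes twoBelow = mk⇔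
  (λ sc _ → wide⇒¬singleColumn (insertAll-wide xs (insert-columnTableau-wide sorted twoBelow)) sc)
  (contradiction (contains-⊆ (++⁺ʳ xs ⊆-refl) (twoBelow⇒contains-∷ʳ sorted s↭pre twoBelow)))
... | no ¬twoBelow
  with s′ , sorted′ , s′↭ , insert≡ ← insert-columnTableau sorted
         (unique-++-∷⇒∉ pre (subst Unique (∷ʳ-++ pre α xs) unique) ∘ ∈-resp-↭ s↭pre) ¬twoBelow
  rewrite insert≡ =
  insertAll-columnTableau xs sorted′ (↭-trans s′↭ (↭-trans (prep α s↭pre) (∷↭∷ʳ α pre))) unique
    (¬twoBelow⇒¬contains-∷ʳ sorted s↭pre ¬twoBelow ¬c)

-- π is split only so that schroderTableau π reduces to insertAll π (columnTableau []).
singleColumn⇔¬contains123or213 : ∀ π → Unique π →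
  SingleColumn (schroderTableau π) ⇔ (¬ Contains123or213 π)
singleColumn⇔¬contains123or213 []        u = insertAll-columnTableau [] [] ↭-refl u λ ()
singleColumn⇔¬contains123or213 (π₁ ∷ πs) u = insertAll-columnTableau (π₁ ∷ πs) [] ↭-refl u λ ()

mainTheorem8 : (n : ℕ) (π : List ℕ) → IsPerm n π →
    SingleColumn (schroderTableau π) ⇔ (Avoids π (1 ∷ 2 ∷ 3 ∷ []) × Avoids π (2 ∷ 1 ∷ 3 ∷ []))
mainTheorem8 n π isPerm =
  ⇔.trans (singleColumn⇔¬contains123or213 π (isPerm⇒unique isPerm)) (¬contains123or213⇔avoids π)
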